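{- Let $\mathcal F$ be a $1$-dense union-closed family over $[n]$ and let $\mathcal K\subseteq\mathcal F$ be nonempty. Then $\langle\mathcal K\rangle_{\mathcal F}=\{B\in\mathcal F:\ \text{there exists }A\in\mathcal K\text{ with }A\subseteq_{\mathcal F}B\}$ is union-closed.
   Context: A family of subsets of $[n]$ is union-closed over $[n]$ if it contains $[n]$ and is closed under pairwise unions; the empty set is never a member of any family, and $2^{[n]}$ denotes all nonempty subsets of $[n]$. The closure of $\mathcal F$ is $\overline{\mathcal F}=\{A\in 2^{[n]}:\ \mathcal F\cup\{A\}\text{ is union-closed}\}$; $\mathcal F$ is $1$-dense if $\mathcal F\ne 2^{[n]}$ and $\overline{\mathcal F}=2^{[n]}$. Relative subsets: for $A,B\in\mathcal F$, $A\subseteq_{\mathcal F}B$ means that $A=B$, or $B=[n]$, or there exists $C\in\mathcal F$ with $C\neq B$ and $A\cup C=B$. -}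

module Defs where

open import Data.Nat using (ℕ)
open import Data.Fin.Subset using (Subset; ⊤; _∪_; Nonempty)
open import Data.Product using (_×_; ∃; ∃-syntax; _,_)
open import Data.Sum using (_⊎_)
open import Relation.Nullary using (¬_)
open import Relation.Binary.PropositionalEquality using (_≡_; _≢_)

Family : ℕ → Set₁
Family n = Subset n → Set

-- Standing convention: the empty set is never a member of a family.
NoEmpty : ∀ {n} → Family n → Set
NoEmpty {n} F = ∀ (A : Subset n) → F A → Nonempty A

UnionClosed : ∀ {n} → Family n → Set
UnionClosed {n} F =
  NoEmpty F × F ⊤ × (∀ (A B : Subset n) → F A → F B → F (A ∪ B))

-- 2^[n]: all nonempty subsets of [n].
AllNonempty : ∀ n → Family n
AllNonempty n A = Nonempty A

insert : ∀ {n} → Family n → Subset n → Family n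
insert F A X = F X ⊎ X ≡ A

Closure : ∀ {n} → Family n → Family n
Closure F A = Nonempty A × UnionClosed (insert F A)

SameFamily : ∀ {n} → Family n → Family n → Set
SameFamily {n} F G = ∀ (A : Subset n) → (F A → G A) × (G A → F A)

OneDense : ∀ {n} → Family n → Set
OneDense {n} F = ¬ SameFamily F (AllNonempty n) × SameFamily (Closure F) (AllNonempty n)

RelSub : ∀ {n} → Family n → Subset n → Subset n → Set
RelSub {n} F A B =
  A ≡ B ⊎ B ≡ ⊤ ⊎ (∃[ C ] (F C × C ≢ B × A ∪ C ≡ B))

Generated : ∀ {n} → Family n → Family n → Family n
Generated F K B = F B × ∃[ A ] (K A × RelSub F A B)

SubFamily : ∀ {n} → Family n → Family n → Set
SubFamily {n} K F = ∀ (A : Subset n) → K A → F A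

module Submission where

-- Let B₁, B₂ ∈ ⟨K⟩_F, witnessed by A₁ ⊆_F B₁ and A₂ ⊆_F B₂,
-- and put B = B₁ ∪ B₂ (which lies in F).  We show A₁ ⊆_F B, except in the
-- degenerate case B₂ = B, where A₂ ⊆_F B₂ = B already.
--   * A₁ = B₁: then A₁ ∪ B₂ = B with B₂ ∈ F and B₂ ≠ B.
--   * B₁ = [n]: then B = [n].
--   * A₁ ∪ C = B₁ with C ∈ F, C ≠ B₁: pick a ∈ B₁ ∖ C (so a ∈ A₁) and let
--     D = B ∖ {a}.  Then A₁ ∪ D = B and D ≠ B, and D ∈ F because D ⊇ C.
-- The last step rests on the key structural fact: a 1-dense family is an
-- up-set among nonempty sets.  For C ∈ F, c ∈ C and C ⊆ D, the set
-- Z = D ∖ {c} is either empty (then D = C) or lies in the closure of F,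
-- so C ∪ Z = D ≠ Z is in F ∪ {Z}, i.e. D ∈ F.

open import Defs
open import Data.Nat using (ℕ)
open import Data.Fin using (Fin; _≟_)
open import Data.Fin.Properties using (¬∀⟶∃¬)
open import Data.Fin.Subset
  using (Subset; ⊥; _∪_; _─_; _-_; _∈_; _∉_; _⊆_; Nonempty; inside; outside)
open import Data.Fin.Subset.Properties
  using ( _∈?_; nonempty?; ⊆-antisym; ⊆-trans; p⊆p∪q; q⊆p∪q; x∈p∪q⁻; x∈p∪q⁺
        ; p─q⊆p; x∈p∧x≢y⇒x∈p-y; x∈⁅x⁆; Empty-unique; ∪-identityʳ; ∪-zeroˡ )
open import Data.Bool using () renaming (_≟_ to _≟ᵇ_)
open import Data.Vec using (_∷_; here; there)
open import Data.Vec.Properties using (≡-dec)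
open import Data.Product using (_×_; ∃-syntax; _,_; proj₁; proj₂)
open import Data.Sum using (_⊎_; inj₁; inj₂)
open import Relation.Nullary using (Dec; yes; no; contradiction)
open import Relation.Nullary.Decidable using (decidable-stable; _→-dec_)
open import Relation.Binary.PropositionalEquality
  using (_≡_; _≢_; refl; sym; trans; cong; subst; module ≡-Reasoning)

x∈p─q⇒x∉q : ∀ {n} {x : Fin n} (p q : Subset n) → x ∈ p ─ q → x ∉ q
x∈p─q⇒x∉q (_ ∷ p) (outside ∷ q) (there x∈p─q) (there x∈q) = x∈p─q⇒x∉q p q x∈p─q x∈q
x∈p─q⇒x∉q (_ ∷ p) (inside  ∷ q) (there x∈p─q) (there x∈q) = x∈p─q⇒x∉q p q x∈p─q x∈q

y∉p-y : ∀ {n} (p : Subset n) (y : Fin n) → y ∉ p - y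
y∉p-y p y y∈p-y = x∈p─q⇒x∉q p _ y∈p-y (x∈⁅x⁆ y)

∪-restores-removed : ∀ {n} {p q : Subset n} {y : Fin n} →
  y ∈ q → q ⊆ p → q ∪ (p - y) ≡ p
∪-restores-removed {p = p} {q} {y} y∈q q⊆p = ⊆-antisym ∪⊆p p⊆∪
  where
  ∪⊆p : q ∪ (p - y) ⊆ p
  ∪⊆p x∈∪ with x∈p∪q⁻ q (p - y) x∈∪
  ... | inj₁ x∈q   = q⊆p x∈q
  ... | inj₂ x∈p-y = p─q⊆p p _ x∈p-y
  p⊆∪ : p ⊆ q ∪ (p - y)
  p⊆∪ {x} x∈p with x ≟ y
  ... | yes refl = x∈p∪q⁺ (inj₁ y∈q)
  ... | no x≢y   = x∈p∪q⁺ (inj₂ (x∈p∧x≢y⇒x∈p-y x∈p x≢y))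

strict-subset-witness : ∀ {n} {p q : Subset n} →
  q ⊆ p → q ≢ p → ∃[ x ] (x ∈ p × x ∉ q)
strict-subset-witness {n} {p} {q} q⊆p q≢p
  with ¬∀⟶∃¬ n (λ x → x ∈ p → x ∈ q) (λ x → x ∈? p →-dec x ∈? q)
                (λ p⊆q → q≢p (⊆-antisym q⊆p (λ {x} → p⊆q x)))
... | x , ¬p⇒q =
  x , decidable-stable (x ∈? p) (λ x∉p → ¬p⇒q (λ x∈p → contradiction x∈p x∉p))
    , (λ x∈q → ¬p⇒q (λ _ → x∈q))

Dense : ∀ {n} → Family n → Set
Dense {n} F = ∀ (Z : Subset n) → Nonempty Z → Closure F Z

oneDense⇒dense : ∀ {n} {F : Family n} → OneDense F → Dense F
oneDense⇒dense (_ , closure≡all) Z = proj₂ (closure≡all Z)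

closure-∪ : ∀ {n} {F : Family n} {Z C : Subset n} →
  Closure F Z → F C → F (C ∪ Z) ⊎ C ∪ Z ≡ Z
closure-∪ {Z = Z} {C} (_ , _ , _ , ∪-closed) FC = ∪-closed C Z (inj₁ FC) (inj₂ refl)

-- With c ∈ C and Z = D - c we have C ∪ Z = D; if Z is
-- empty then D = C, otherwise F ∪ {Z} is union-closed, and C ∪ Z ≠ Z
-- (as c ∉ Z) forces C ∪ Z ∈ F.
dense⇒upClosed : ∀ {n} {F : Family n} {C D : Subset n} →
  Dense F → F C → Nonempty C → C ⊆ D → F D
dense⇒upClosed {F = F} {C} {D} dense FC (c , c∈C) C⊆D = F[D]
  where
  Z : Subset _
  Z = D - c

  C∪Z≡D : C ∪ Z ≡ D
  C∪Z≡D = ∪-restores-removed c∈C C⊆D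

  F[D] : F D
  F[D] with nonempty? Z
  ... | no Z-empty = subst F C≡D FC
    where
    open ≡-Reasoning
    C≡D : C ≡ D
    C≡D = begin
      C        ≡⟨ ∪-identityʳ C ⟨
      C ∪ ⊥    ≡⟨ cong (C ∪_) (Empty-unique Z-empty) ⟨
      C ∪ Z    ≡⟨ C∪Z≡D ⟩
      D        ∎
  ... | yes Z-ne with closure-∪ (dense Z Z-ne) FC
  ...   | inj₁ F[C∪Z] = subst F C∪Z≡D F[C∪Z]
  ...   | inj₂ C∪Z≡Z  = contradiction (subst (c ∈_) C∪Z≡Z (x∈p∪q⁺ (inj₁ c∈C))) (y∉p-y D c)

-- Take a ∈ B ∖ C (hence a ∈ A) and D = B' - a,
-- which contains C and so lies in F by the up-set property.
proper-witness-extends : ∀ {n} {F : Family n} {A B B' C : Subset n} →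
  Dense F → F C → Nonempty C → C ≢ B → A ∪ C ≡ B → B ⊆ B' →
  ∃[ D ] (F D × D ≢ B' × A ∪ D ≡ B')
proper-witness-extends {A = A} {B} {B'} {C} dense FC C-ne C≢B A∪C≡B B⊆B' =
  B' - a , dense⇒upClosed dense FC C-ne C⊆D , D≢B' , ∪-restores-removed a∈A A⊆B'
  where
  C⊆B : C ⊆ B
  C⊆B = subst (C ⊆_) A∪C≡B (q⊆p∪q A C)

  A⊆B' : A ⊆ B'
  A⊆B' = ⊆-trans (subst (A ⊆_) A∪C≡B (p⊆p∪q C)) B⊆B'

  a-spec : ∃[ a ] (a ∈ B × a ∉ C)
  a-spec = strict-subset-witness C⊆B C≢B

  a : Fin _
  a = proj₁ a-spec

  a∈A : a ∈ A
  a∈A with x∈p∪q⁻ A C (subst (a ∈_) (sym A∪C≡B) (proj₁ (proj₂ a-spec)))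
  ... | inj₁ a∈A = a∈A
  ... | inj₂ a∈C = contradiction a∈C (proj₂ (proj₂ a-spec))

  C⊆D : C ⊆ B' - a
  C⊆D {x} x∈C = x∈p∧x≢y⇒x∈p-y (B⊆B' (C⊆B x∈C))
                  (λ { refl → proj₂ (proj₂ a-spec) x∈C })

  D≢B' : B' - a ≢ B'
  D≢B' D≡B' = y∉p-y B' a (subst (a ∈_) (sym D≡B') (A⊆B' a∈A))

relSub-∪ : ∀ {n} {F : Family n} {A B₁ B₂ : Subset n} →
  Dense F → NoEmpty F → F B₂ → B₂ ≢ B₁ ∪ B₂ →
  RelSub F A B₁ → RelSub F A (B₁ ∪ B₂)
relSub-∪ {B₂ = B₂} _ _ FB₂ B₂≢B (inj₁ A≡B₁) =
  inj₂ (inj₂ (B₂ , FB₂ , B₂≢B , cong (_∪ B₂) A≡B₁))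
relSub-∪ {B₂ = B₂} _ _ _ _ (inj₂ (inj₁ B₁≡⊤)) =
  inj₂ (inj₁ (trans (cong (_∪ B₂) B₁≡⊤) (∪-zeroˡ B₂)))
relSub-∪ {B₂ = B₂} dense noEmpty _ _ (inj₂ (inj₂ (C , FC , C≢B₁ , A∪C≡B₁))) =
  inj₂ (inj₂ (proper-witness-extends dense FC (noEmpty C FC) C≢B₁ A∪C≡B₁ (p⊆p∪q B₂)))

_≟ₛ_ : ∀ {n} (p q : Subset n) → Dec (p ≡ q)
_≟ₛ_ = ≡-dec _≟ᵇ_

-- For B₁, B₂ ∈ ⟨K⟩_F with witnesses
-- A₁, A₂: if B₂ = B₁ ∪ B₂, A₂ still witnesses it; otherwise A₁ does, by
-- relSub-∪.
lemma8 : ∀ (n : ℕ) (F K : Family n) →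
    UnionClosed F → OneDense F →
    SubFamily K F → ∃[ A ] K A →
    UnionClosed (Generated F K)
lemma8 n F K (noEmpty , F⊤ , F-∪) oneDense _ (A , KA) =
  (λ B B∈⟨K⟩ → noEmpty B (proj₁ B∈⟨K⟩)) , (F⊤ , A , KA , inj₂ (inj₁ refl)) , ⟨K⟩-∪
  where
  ⟨K⟩-∪ : ∀ (B₁ B₂ : Subset n) →
    Generated F K B₁ → Generated F K B₂ → Generated F K (B₁ ∪ B₂)
  ⟨K⟩-∪ B₁ B₂ (FB₁ , A₁ , KA₁ , A₁⊆B₁) (FB₂ , A₂ , KA₂ , A₂⊆B₂) with B₂ ≟ₛ (B₁ ∪ B₂)
  ... | yes B₂≡B = F-∪ B₁ B₂ FB₁ FB₂ , A₂ , KA₂ , subst (RelSub F A₂) B₂≡B A₂⊆B₂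
  ... | no B₂≢B  = F-∪ B₁ B₂ FB₁ FB₂ , A₁ , KA₁ ,
                   relSub-∪ (oneDense⇒dense oneDense) noEmpty FB₂ B₂≢B A₁⊆B₁
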